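{- Let $G=(V,E,w)$ be an undirected graph with $m=|E|$ edges and non-negative edge weights such that all shortest paths are unique. Suppose the edge capacities are distinct and their relative order is a uniformly random permutation of $1,\dots,m$, and for $X\subseteq V$ let $f(X)$ be the expected number of bottleneck edges from $X$ to $V$. Then $f$ is monotone and submodular: for all $X\subseteq V$ and $w\in V$, $f(X\cup\{w\})\ge f(X)$; and for all $X\subseteq Y\subseteq V$ and $w\in V$, $f(X\cup\{w\})-f(X)\ge f(Y\cup\{w\})-f(Y)$.
   Context: For vertices $s,t$, $P(s,t)$ denotes the unique shortest path from $s$ to $t$. Each edge $e$ has a capacity $c(e)$. An edge $e_i$ on $P(s,t)$ with edges $e_1,\dots,e_\ell$ is a bottleneck edge along $P(s,t)$ if $c(e_i)<c(e_j)$ for all $j\ne i$. The bottleneck edges from a set $S\subseteq V$ to $V$ are the edges that are a bottleneck edge along $P(s,t)$ for some $s\in S$ and some $t\in V$.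
   Formalization: The non-negative edge weights take values in the rationals. -}

module Defs where

open import Data.Nat using (ℕ; zero; suc) renaming (_+_ to _+ℕ_)
open import Data.Fin using (Fin; zero; suc; _≟_) renaming (_<_ to _<F_)
open import Data.Fin.Properties using (all?)
open import Data.Fin.Subset using (Subset; _∈_; ∣_∣)
open import Data.List using (List; []; _∷_; map; concatMap; filter; foldr; length; allFin)
open import Data.List.Membership.Propositional renaming (_∈_ to _∈ₗ_)
open import Data.List.Relation.Unary.Unique.Propositional using (Unique)
open import Data.Product using (Σ; ∃; _×_; _,_)
open import Data.Sum using (_⊎_)
open import Data.Integer using (+_)
open import Data.Rational using (ℚ; 0ℚ; _+_; _/_; _≤_; _<_)
open import Relation.Binary.PropositionalEquality using (_≡_; _≢_)
open import Relation.Nullary using (Dec)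
open import Relation.Nullary.Decidable using (_→-dec_)
open import Function.Bundles using (_⇔_)

-- An undirected graph on vertex set Fin n with m edges (edge set Fin m).
-- Edge e has endpoints src e and dst e (orientation irrelevant) and
-- weight wt e.

record Graph (n m : ℕ) : Set where
  field
    src : Fin m → Fin n
    dst : Fin m → Fin n
    wt  : Fin m → ℚ

record IsSimple {n m : ℕ} (G : Graph n m) : Set where
  open Graph G
  field
    noLoop     : ∀ e → src e ≢ dst e
    noParallel : ∀ e e' →
                 ((src e ≡ src e' × dst e ≡ dst e') ⊎ (src e ≡ dst e' × dst e ≡ src e'))
                 → e ≡ e'

module _ {n m : ℕ} (G : Graph n m) where
  open Graph G

  Joins : Fin m → Fin n → Fin n → Set
  Joins e u v = (src e ≡ u × dst e ≡ v) ⊎ (src e ≡ v × dst e ≡ u)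

  data Walk : Fin n → Fin n → List (Fin n) → List (Fin m) → Set where
    here : ∀ {s} → Walk s s (s ∷ []) []
    step : ∀ {e u v t vs es} → Joins e u v → Walk v t vs es → Walk u t (u ∷ vs) (e ∷ es)

  IsPath : Fin n → Fin n → List (Fin m) → Set
  IsPath s t es = Σ (List (Fin n)) λ vs → Walk s t vs es × Unique vs

  pathWeight : List (Fin m) → ℚ
  pathWeight = foldr (λ e r → wt e + r) 0ℚ

  IsShortestPath : Fin n → Fin n → List (Fin m) → Set
  IsShortestPath s t es =
    IsPath s t es × (∀ es' → IsPath s t es' → pathWeight es ≤ pathWeight es')

  UniqueShortestPaths : Set
  UniqueShortestPaths = ∀ s t es es' → IsShortestPath s t es → IsShortestPath s t es' → es ≡ es'

  IsBottleneck : (Fin m → Fin m) → Fin m → List (Fin m) → Set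
  IsBottleneck c e es = e ∈ₗ es × (∀ e' → e' ∈ₗ es → e' ≢ e → c e <F c e')

  IsBottleneckFrom : (Fin m → Fin m) → Subset n → Fin m → Set
  IsBottleneckFrom c X e =
    Σ (Fin n) λ s → Σ (Fin n) λ t → Σ (List (Fin m)) λ es →
      s ∈ X × IsShortestPath s t es × IsBottleneck c e es

-- Uniformly random relative order of capacities: all permutations of Fin m
-- (as bijective = injective maps Fin m → Fin m), each equally likely.

allFuns : (k n : ℕ) → List (Fin k → Fin n)
allFuns zero    n = (λ ()) ∷ []
allFuns (suc k) n =
  concatMap (λ f → map (λ x → cons x f) (allFin n)) (allFuns k n)
  where
  cons : Fin n → (Fin k → Fin n) → Fin (suc k) → Fin n
  cons x f zero    = x
  cons x f (suc i) = f i

Injective? : {m : ℕ} → (f : Fin m → Fin m) → Dec (∀ i j → f i ≡ f j → i ≡ j)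
Injective? f = all? λ i → all? λ j → (f i ≟ f j) →-dec (i ≟ j)

permutations : (m : ℕ) → List (Fin m → Fin m)
permutations m = filter Injective? (allFuns m m)

-- mean of a list of naturals (0 for the empty list): the expectation
-- under the uniform distribution on the list
sumℕ : List ℕ → ℕ
sumℕ = foldr _+ℕ_ 0

mean : List ℕ → ℚ
mean []       = 0ℚ
mean (x ∷ xs) = (+ sumℕ (x ∷ xs)) / suc (length xs)

BottleneckSetSpec : {n m : ℕ} → Graph n m → ((Fin m → Fin m) → Subset n → Subset m) → Set
BottleneckSetSpec {n} {m} G B =
  ∀ c X e → (e ∈ B c X) ⇔ IsBottleneckFrom G c X e

expectedBottlenecks : {n m : ℕ} → ((Fin m → Fin m) → Subset n → Subset m) → Subset n → ℚ
expectedBottlenecks {n} {m} B X = mean (map (λ c → ∣ B c X ∣) (permutations m))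

-- For a fixed capacity order c, an edge is a bottleneck from X exactly when it
-- is a bottleneck from some single source s ∈ X, so X ↦ B c X is a coverage map:
-- a union of per-source edge sets. Hence B c is monotone and
-- B c (Y ∪ Z) ⊆ B c (X ∪ Z) ∪ B c Y and B c X ⊆ B c (X ∪ Z) ∩ B c Y for X ⊆ Y,
-- and inclusion–exclusion turns these into monotonicity and submodularity of
-- ∣ B c X ∣. Averaging over all orders c preserves both, since the mean is
-- monotone and additive.
module Submission where

open import Defs
open import Data.Nat using (ℕ)
open import Data.Fin using (Fin)
open import Data.Fin.Subset using (Subset; _∪_; ⁅_⁆; _⊆_)
open import Data.Rational using (ℚ; 0ℚ; _≤_; _-_)
open import Data.Product using (_×_)

open import Data.Nat as ℕ using (suc; z≤n)
import Data.Nat.Properties as ℕ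
open import Algebra.Properties.CommutativeSemigroup ℕ.+-commutativeSemigroup using (interchange)
open import Data.Fin.Subset using (inside; outside; _∩_; ∣_∣; _∈_)
open import Data.Fin.Subset.Properties using (p⊆q⇒∣p∣≤∣q∣; p⊆p∪q; q⊆p∪q; x∈p∪q⁻; x∈p∪q⁺; x∈p∩q⁺)
open import Data.Vec using ([]; _∷_)
open import Data.List using ([]; _∷_; map; length)
open import Data.List.Properties using (length-map)
open import Data.Product using (∃-syntax; _,_)
import Data.Sum as Sum
open import Data.Integer as ℤ using (ℤ; +_)
import Data.Integer.Properties as ℤ
open import Data.Integer.Tactic.RingSolver using (solve-∀)
open import Data.Rational using (_+_; -_; _/_; toℚᵘ)
open import Data.Rational.Properties
  using (toℚᵘ-fromℚᵘ; toℚᵘ-cancel-≤; toℚᵘ-injective; toℚᵘ-homo-+; ≤-refl; +-monoˡ-≤)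
open import Data.Rational.Solver using (module +-*-Solver)
import Data.Rational.Unnormalised as ℚᵘ
import Data.Rational.Unnormalised.Properties as ℚᵘ
open import Function.Base using (case_of_)
open import Function.Bundles using (_⇔_; mk⇔; module Equivalence)
open import Relation.Binary.PropositionalEquality

∣p∪q∣+∣p∩q∣≡∣p∣+∣q∣ : ∀ {n} (p q : Subset n) → ∣ p ∪ q ∣ ℕ.+ ∣ p ∩ q ∣ ≡ ∣ p ∣ ℕ.+ ∣ q ∣
∣p∪q∣+∣p∩q∣≡∣p∣+∣q∣ []            []            = refl
∣p∪q∣+∣p∩q∣≡∣p∣+∣q∣ (inside  ∷ p) (inside  ∷ q) = cong suc (begin
  ∣ p ∪ q ∣ ℕ.+ suc ∣ p ∩ q ∣   ≡⟨ ℕ.+-suc ∣ p ∪ q ∣ ∣ p ∩ q ∣ ⟩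
  suc (∣ p ∪ q ∣ ℕ.+ ∣ p ∩ q ∣) ≡⟨ cong suc (∣p∪q∣+∣p∩q∣≡∣p∣+∣q∣ p q) ⟩
  suc (∣ p ∣ ℕ.+ ∣ q ∣)         ≡⟨ ℕ.+-suc ∣ p ∣ ∣ q ∣ ⟨
  ∣ p ∣ ℕ.+ suc ∣ q ∣           ∎)
  where open ≡-Reasoning
∣p∪q∣+∣p∩q∣≡∣p∣+∣q∣ (inside  ∷ p) (outside ∷ q) = cong suc (∣p∪q∣+∣p∩q∣≡∣p∣+∣q∣ p q)
∣p∪q∣+∣p∩q∣≡∣p∣+∣q∣ (outside ∷ p) (inside  ∷ q) =
  trans (cong suc (∣p∪q∣+∣p∩q∣≡∣p∣+∣q∣ p q)) (sym (ℕ.+-suc ∣ p ∣ ∣ q ∣))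
∣p∪q∣+∣p∩q∣≡∣p∣+∣q∣ (outside ∷ p) (outside ∷ q) = ∣p∪q∣+∣p∩q∣≡∣p∣+∣q∣ p q

∣p∣+∣q∣≤∣r∣+∣s∣ : ∀ {n} {p q r s : Subset n} → p ⊆ r ∪ s → q ⊆ r ∩ s →
                  ∣ p ∣ ℕ.+ ∣ q ∣ ℕ.≤ ∣ r ∣ ℕ.+ ∣ s ∣
∣p∣+∣q∣≤∣r∣+∣s∣ {p = p} {q} {r} {s} p⊆r∪s q⊆r∩s = begin
  ∣ p ∣ ℕ.+ ∣ q ∣         ≤⟨ ℕ.+-mono-≤ (p⊆q⇒∣p∣≤∣q∣ p⊆r∪s) (p⊆q⇒∣p∣≤∣q∣ q⊆r∩s) ⟩
  ∣ r ∪ s ∣ ℕ.+ ∣ r ∩ s ∣ ≡⟨ ∣p∪q∣+∣p∩q∣≡∣p∣+∣q∣ r s ⟩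
  ∣ r ∣ ℕ.+ ∣ s ∣         ∎
  where open ℕ.≤-Reasoning

module _ {n m : ℕ} where

  IsCoverage : (Fin n → Fin m → Set) → (Subset n → Subset m) → Set
  IsCoverage R F = ∀ X e → e ∈ F X ⇔ (∃[ s ] (s ∈ X × R s e))

  module _ {R : Fin n → Fin m → Set} {F : Subset n → Subset m} (cov : IsCoverage R F) where
    open Equivalence

    coverage-mono : ∀ {X Y} → X ⊆ Y → F X ⊆ F Y
    coverage-mono {X} {Y} X⊆Y {e} e∈FX with to (cov X e) e∈FX
    ... | s , s∈X , Rse = from (cov Y e) (s , X⊆Y s∈X , Rse)

    coverage-∪ : ∀ X Y → F (X ∪ Y) ⊆ F X ∪ F Y
    coverage-∪ X Y {e} e∈F[X∪Y] with to (cov (X ∪ Y) e) e∈F[X∪Y]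
    ... | s , s∈X∪Y , Rse = x∈p∪q⁺ (Sum.map (λ s∈X → from (cov X e) (s , s∈X , Rse))
                                            (λ s∈Y → from (cov Y e) (s , s∈Y , Rse))
                                            (x∈p∪q⁻ X Y s∈X∪Y))

    ∣coverage∣-mono : ∀ {X Y} → X ⊆ Y → ∣ F X ∣ ℕ.≤ ∣ F Y ∣
    ∣coverage∣-mono X⊆Y = p⊆q⇒∣p∣≤∣q∣ (coverage-mono X⊆Y)

    ∣coverage∣-submodular : ∀ {X Y} Z → X ⊆ Y →
      ∣ F (Y ∪ Z) ∣ ℕ.+ ∣ F X ∣ ℕ.≤ ∣ F (X ∪ Z) ∣ ℕ.+ ∣ F Y ∣
    ∣coverage∣-submodular {X} {Y} Z X⊆Y = ∣p∣+∣q∣≤∣r∣+∣s∣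
      (λ e∈F[Y∪Z] → x∈p∪q⁺ (Sum.swap (Sum.map₂ (coverage-mono (q⊆p∪q X Z))
                                                (x∈p∪q⁻ (F Y) (F Z) (coverage-∪ Y Z e∈F[Y∪Z])))))
      (λ e∈FX → x∈p∩q⁺ (coverage-mono (p⊆p∪q Z) e∈FX , coverage-mono X⊆Y e∈FX))

-- + a / suc j is definitionally fromℚᵘ (+ a ℚᵘ./ suc j).
toℚᵘ-/ : ∀ a j → toℚᵘ (+ a / suc j) ℚᵘ.≃ (+ a ℚᵘ./ suc j)
toℚᵘ-/ a j = toℚᵘ-fromℚᵘ (+ a ℚᵘ./ suc j)

/-monoˡ-≤ : ∀ j {a b} → a ℕ.≤ b → + a / suc j ≤ + b / suc j
/-monoˡ-≤ j {a} {b} a≤b = toℚᵘ-cancel-≤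
  (ℚᵘ.≤-respˡ-≃ (ℚᵘ.≃-sym (toℚᵘ-/ a j)) (ℚᵘ.≤-respʳ-≃ (ℚᵘ.≃-sym (toℚᵘ-/ b j))
    (ℚᵘ.*≤* (ℤ.*-monoʳ-≤-nonNeg (+ suc j) (ℤ.+≤+ a≤b)))))

/-distribʳ-+ : ∀ j a b → + (a ℕ.+ b) / suc j ≡ + a / suc j + + b / suc j
/-distribʳ-+ j a b = toℚᵘ-injective (ℚᵘ.≃-trans (toℚᵘ-/ (a ℕ.+ b) j) (ℚᵘ.≃-sym (ℚᵘ.≃-trans
  (toℚᵘ-homo-+ (+ a / suc j) (+ b / suc j))
  (ℚᵘ.≃-trans (ℚᵘ.+-cong (toℚᵘ-/ a j) (toℚᵘ-/ b j)) (ℚᵘ.*≡* numerators)))))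
  where
  d : ℤ
  d = + suc j
  numerators : (+ a ℤ.* d ℤ.+ + b ℤ.* d) ℤ.* d ≡ + (a ℕ.+ b) ℤ.* + (suc j ℕ.* suc j)
  numerators = trans (distrib (+ a) (+ b) d)
    (sym (cong₂ ℤ._*_ (ℤ.pos-+ a b) (ℤ.pos-* (suc j) (suc j))))
    where
    distrib : ∀ x y z → (x ℤ.* z ℤ.+ y ℤ.* z) ℤ.* z ≡ (x ℤ.+ y) ℤ.* (z ℤ.* z)
    distrib = solve-∀

p+q≤r+s⇒p-s≤r-q : ∀ {p q r s} → p + q ≤ r + s → p - s ≤ r - q
p+q≤r+s⇒p-s≤r-q {p} {q} {r} {s} h =
  subst₂ _≤_ (cancelˡ p q s) (cancelʳ r s q) (+-monoˡ-≤ (- (q + s)) h)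
  where
  open +-*-Solver
  cancelˡ : ∀ x y z → x + y - (y + z) ≡ x - z
  cancelˡ = solve 3 (λ x y z → (x :+ y) :- (y :+ z) := x :- z) refl
  cancelʳ : ∀ x y z → x + y - (z + y) ≡ x - z
  cancelʳ = solve 3 (λ x y z → (x :+ y) :- (z :+ y) := x :- z) refl

module _ {A : Set} where

  sum-map-mono : ∀ {f g : A → ℕ} → (∀ x → f x ℕ.≤ g x) →
                 ∀ xs → sumℕ (map f xs) ℕ.≤ sumℕ (map g xs)
  sum-map-mono f≤g []       = z≤n
  sum-map-mono f≤g (x ∷ xs) = ℕ.+-mono-≤ (f≤g x) (sum-map-mono f≤g xs)

  sum-map-+ : ∀ (f g : A → ℕ) xs →
              sumℕ (map (λ x → f x ℕ.+ g x) xs) ≡ sumℕ (map f xs) ℕ.+ sumℕ (map g xs)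
  sum-map-+ f g []       = refl
  sum-map-+ f g (x ∷ xs) = trans (cong (f x ℕ.+ g x ℕ.+_) (sum-map-+ f g xs))
                                 (interchange (f x) (g x) (sumℕ (map f xs)) (sumℕ (map g xs)))

  mean-map-∷ : ∀ (f : A → ℕ) x xs → mean (map f (x ∷ xs)) ≡ + sumℕ (map f (x ∷ xs)) / suc (length xs)
  mean-map-∷ f x xs = cong (λ k → + sumℕ (map f (x ∷ xs)) / suc k) (length-map f xs)

  mean-map-mono : ∀ {f g : A → ℕ} → (∀ x → f x ℕ.≤ g x) →
                  ∀ xs → mean (map f xs) ≤ mean (map g xs)
  mean-map-mono         f≤g []       = ≤-refl
  mean-map-mono {f} {g} f≤g (x ∷ xs) =
    subst₂ _≤_ (sym (mean-map-∷ f x xs)) (sym (mean-map-∷ g x xs))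
      (/-monoˡ-≤ (length xs) (sum-map-mono f≤g (x ∷ xs)))

  mean-map-+ : ∀ (f g : A → ℕ) xs →
               mean (map (λ x → f x ℕ.+ g x) xs) ≡ mean (map f xs) + mean (map g xs)
  mean-map-+ f g []       = refl
  mean-map-+ f g (x ∷ xs) = begin
    mean (map (λ x → f x ℕ.+ g x) (x ∷ xs))        ≡⟨ mean-map-∷ (λ x → f x ℕ.+ g x) x xs ⟩
    + Σ (λ x → f x ℕ.+ g x) / k                    ≡⟨ cong (λ a → + a / k) (sum-map-+ f g (x ∷ xs)) ⟩
    + (Σ f ℕ.+ Σ g) / k                            ≡⟨ /-distribʳ-+ (length xs) (Σ f) (Σ g) ⟩
    + Σ f / k + + Σ g / k                          ≡⟨ cong₂ _+_ (mean-map-∷ f x xs) (mean-map-∷ g x xs) ⟨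
    mean (map f (x ∷ xs)) + mean (map g (x ∷ xs)) ∎
    where
    open ≡-Reasoning
    k : ℕ
    k = suc (length xs)
    Σ : (A → ℕ) → ℕ
    Σ h = sumℕ (map h (x ∷ xs))

  mean-map-submodular : ∀ {f g h k : A → ℕ} → (∀ x → f x ℕ.+ g x ℕ.≤ h x ℕ.+ k x) →
    ∀ xs → mean (map f xs) - mean (map k xs) ≤ mean (map h xs) - mean (map g xs)
  mean-map-submodular {f} {g} {h} {k} f+g≤h+k xs = p+q≤r+s⇒p-s≤r-q {μ f} {μ g} {μ h} {μ k}
    (subst₂ _≤_ (mean-map-+ f g xs) (mean-map-+ h k xs) (mean-map-mono f+g≤h+k xs))
    where
    μ : (A → ℕ) → ℚ
    μ φ = mean (map φ xs)

module _ {n m : ℕ} (G : Graph n m) where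

  IsBottleneckFromVertex : (Fin m → Fin m) → Fin n → Fin m → Set
  IsBottleneckFromVertex c s e =
    ∃[ t ] ∃[ es ] (IsShortestPath G s t es × IsBottleneck G c e es)

  bottleneckSet-isCoverage : ∀ {B} → BottleneckSetSpec G B →
                             ∀ c → IsCoverage (IsBottleneckFromVertex c) (B c)
  bottleneckSet-isCoverage spec c X e = mk⇔
    (λ e∈B → case Equivalence.to (spec c X e) e∈B of λ where
      (s , t , es , s∈X , sp , bn) → s , s∈X , t , es , sp , bn)
    (λ where (s , s∈X , t , es , sp , bn) → Equivalence.from (spec c X e) (s , t , es , s∈X , sp , bn))

mainTheorem2 : ∀ {n m : ℕ} (G : Graph n m) → IsSimple G
    → (∀ e → 0ℚ ≤ Graph.wt G e)
    → UniqueShortestPaths G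
    → (B : (Fin m → Fin m) → Subset n → Subset m) → BottleneckSetSpec G B
    → (∀ (X : Subset n) (u : Fin n) →
          expectedBottlenecks B X ≤ expectedBottlenecks B (X ∪ ⁅ u ⁆))
      × (∀ (X Y : Subset n) (u : Fin n) → X ⊆ Y →
          expectedBottlenecks B (Y ∪ ⁅ u ⁆) - expectedBottlenecks B Y
            ≤ expectedBottlenecks B (X ∪ ⁅ u ⁆) - expectedBottlenecks B X)
mainTheorem2 {m = m} G _ _ _ B spec =
    (λ X u → mean-map-mono (λ c → ∣coverage∣-mono (cover c) (p⊆p∪q ⁅ u ⁆)) (permutations m))
  , (λ X Y u X⊆Y → mean-map-submodular (λ c → ∣coverage∣-submodular (cover c) ⁅ u ⁆ X⊆Y) (permutations m))
  where
  cover : ∀ c → IsCoverage (IsBottleneckFromVertex G c) (B c)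
  cover = bottleneckSet-isCoverage G spec
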